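{- Let $n\ge 1$, $K=\{1,\ldots,n\}$, $\mathbf{x}\in\mathbb{R}^n$ and $\bar{\mathbf{x}}=\mathbf{1}-\mathbf{x}$. For each $k\in K$, $x_k\in\{0,1\}$ holds if and only if $x_k\in[0,1]$ and $$\min_{\boldsymbol{\lambda},\bar{\boldsymbol{\lambda}}}\Big\{\mathbf{x}^\top\boldsymbol{\lambda}+\bar{\mathbf{x}}^\top\bar{\boldsymbol{\lambda}}\Big\}\le 0,$$ where the minimum is over $\boldsymbol{\lambda},\bar{\boldsymbol{\lambda}}\in\mathbb{R}^n$ satisfying $\boldsymbol{\lambda}\ge\mathbf{0}$, $\bar{\boldsymbol{\lambda}}\ge\mathbf{0}$, $\sum_{i\in K}(\lambda_i+\bar\lambda_i)=1$, $\sum_{i\in K} i(\lambda_i+\bar\lambda_i)=k$, and $\sum_{i\in K} i^2(\lambda_i+\bar\lambda_i)=k^2$.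
   Context: $\mathbf{1}$ denotes the all-ones vector in $\mathbb{R}^n$; vector inequalities are componentwise. -}

module Defs where

open import Level using (Level; _⊔_) renaming (suc to lsuc)
open import Algebra.Bundles using (CommutativeRing)
open import Relation.Binary.Core using (Rel)
open import Relation.Binary.Structures using (IsTotalOrder)
open import Relation.Nullary using (¬_)
open import Data.Product using (Σ; _×_; ∃)
open import Data.Nat using (ℕ; zero; suc)
open import Data.Fin using (Fin; toℕ) renaming (zero to fzero; suc to fsuc)

record OrderedField c ℓ ℓ₂ : Set (lsuc (c ⊔ ℓ ⊔ ℓ₂)) where
  field
    commRing : CommutativeRing c ℓ
  open CommutativeRing commRing public
  field
    _≤_          : Rel Carrier ℓ₂
    isTotalOrder : IsTotalOrder _≈_ _≤_
    0≉1          : ¬ (0# ≈ 1#)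
    inverse      : ∀ x → ¬ (x ≈ 0#) → ∃ λ y → x * y ≈ 1#
    +-mono-≤     : ∀ {x y} z → x ≤ y → (x + z) ≤ (y + z)
    *-nonneg     : ∀ {x y} → 0# ≤ x → 0# ≤ y → 0# ≤ (x * y)

module _ {c ℓ ℓ₂} (F : OrderedField c ℓ ℓ₂) where
  open OrderedField F

  ι : ℕ → Carrier
  ι zero    = 0#
  ι (suc m) = 1# + ι m

  -- Σ_{i ∈ K} f i  (K indexed by Fin n; i : Fin n stands for the index toℕ i + 1)
  sumK : ∀ {n} → (Fin n → Carrier) → Carrier
  sumK {zero}  f = 0#
  sumK {suc n} f = f fzero + sumK (λ i → f (fsuc i))

  idx : ∀ {n} → Fin n → Carrier
  idx i = ι (suc (toℕ i))

  Feasible : ∀ {n} → Fin n → (Fin n → Carrier) → (Fin n → Carrier) → Set (ℓ ⊔ ℓ₂)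
  Feasible k lam lamb =
    (∀ i → 0# ≤ lam i) × (∀ i → 0# ≤ lamb i)
    × (sumK (λ i → lam i + lamb i) ≈ 1#)
    × (sumK (λ i → idx i * (lam i + lamb i)) ≈ idx k)
    × (sumK (λ i → (idx i * idx i) * (lam i + lamb i)) ≈ idx k * idx k)

  objective : ∀ {n} → (Fin n → Carrier) → (Fin n → Carrier) → (Fin n → Carrier) → Carrier
  objective x lam lamb = sumK (λ i → x i * lam i) + sumK (λ i → (1# - x i) * lamb i)

  IsMinimum : ∀ {n} → Fin n → (Fin n → Carrier) → Carrier → Set (c ⊔ ℓ ⊔ ℓ₂)
  IsMinimum k x v =
    (Σ (Fin _ → Carrier) λ lam → Σ (Fin _ → Carrier) λ lamb →
       Feasible k lam lamb × (objective x lam lamb ≈ v))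
    × (∀ lam lamb → Feasible k lam lamb → v ≤ objective x lam lamb)

-- Feasibility says that μ = λ + λ̄ is a probability measure on K with mean k and
-- second moment k², so its variance Σ (i − k)² μᵢ vanishes and μ is the point mass
-- at k. The objective then collapses to x_k λ_k + (1 − x_k) λ̄_k with λ_k + λ̄_k = 1.
-- For x_k ∈ [0, 1] both terms are nonnegative, so the objective is ≤ 0 only if both
-- vanish, and the larger of λ_k, λ̄_k is nonzero, forcing x_k = 0 or x_k = 1.
-- Conversely, for x_k ∈ {0, 1} the point mass put on the vanishing coefficient
-- attains 0.
module Submission where

open import Defs
open import Data.Nat using (ℕ) renaming (_≤_ to _≤ℕ_)
open import Data.Fin using (Fin)
open import Data.Product using (Σ; _×_)
open import Data.Sum using (_⊎_)
open import Function.Bundles using (_⇔_)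

open import Data.Nat using (zero; suc)
open import Data.Fin using (_≟_) renaming (zero to fzero; suc to fsuc)
open import Data.Fin.Properties using (toℕ-injective; suc-injective)
import Data.Nat.Properties as ℕ
open import Data.Product using (_,_; proj₁; proj₂)
open import Data.Sum using (inj₁; inj₂)
open import Function.Base using (_∘_; _∘₂_)
open import Function.Bundles using (mk⇔)
open import Relation.Nullary using (¬_; yes; no; contradiction)
open import Relation.Binary.Structures using (IsTotalOrder)
import Relation.Binary.PropositionalEquality as ≡
open ≡ using (_≡_; _≢_)
import Algebra.Properties.Ring as RingProperties
import Algebra.Properties.Semiring.Sum as SemiringSum
import Algebra.Solver.Ring.NaturalCoefficients.Default as SemiringSolver

module _ {c ℓ ℓ₂} (F : OrderedField c ℓ ℓ₂) where
  open OrderedField F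
  open RingProperties ring
    using (+-cancelʳ; -‿involutive; -‿distribˡ-*; -‿distribʳ-*; //-rightDividesˡ; x∙y⁻¹≈ε⇒x≈y; x≈y⇒x∙y⁻¹≈ε)
  open SemiringSum semiring using (sum; sum-cong-≋; sum-replicate-zero; ∑-distrib-+; *-distribˡ-sum)
  open SemiringSolver commutativeSemiring using (solve; _:=_; _:+_; _:*_; con)
  open import Relation.Binary.Reasoning.Setoid setoid
  private
    module O = IsTotalOrder isTotalOrder


  ≤-resp-≈ : ∀ {x x′ y y′} → x ≈ x′ → y ≈ y′ → x ≤ y → x′ ≤ y′
  ≤-resp-≈ x≈x′ y≈y′ x≤y = O.trans (O.reflexive (sym x≈x′)) (O.trans x≤y (O.reflexive y≈y′))

  x≤x+y : ∀ x {y} → 0# ≤ y → x ≤ (x + y)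
  x≤x+y x {y} 0≤y = ≤-resp-≈ (+-identityˡ x) (+-comm y x) (+-mono-≤ x 0≤y)

  +-nonneg : ∀ {x y} → 0# ≤ x → 0# ≤ y → 0# ≤ (x + y)
  +-nonneg {x} 0≤x 0≤y = O.trans 0≤x (x≤x+y x 0≤y)

  +-nonneg-≤0⇒ˡ≈0 : ∀ {x y} → 0# ≤ x → 0# ≤ y → (x + y) ≤ 0# → x ≈ 0#
  +-nonneg-≤0⇒ˡ≈0 {x} 0≤x 0≤y x+y≤0 = O.antisym (O.trans (x≤x+y x 0≤y) x+y≤0) 0≤x

  +-nonneg-≤0⇒ʳ≈0 : ∀ {x y} → 0# ≤ x → 0# ≤ y → (x + y) ≤ 0# → y ≈ 0#
  +-nonneg-≤0⇒ʳ≈0 0≤x 0≤y x+y≤0 = +-nonneg-≤0⇒ˡ≈0 0≤y 0≤x (≤-resp-≈ (+-comm _ _) refl x+y≤0)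

  x≤y⇒0≤y-x : ∀ {x y} → x ≤ y → 0# ≤ (y - x)
  x≤y⇒0≤y-x {x} x≤y = ≤-resp-≈ (-‿inverseʳ x) refl (+-mono-≤ (- x) x≤y)

  x≤0⇒0≤-x : ∀ {x} → x ≤ 0# → 0# ≤ (- x)
  x≤0⇒0≤-x x≤0 = ≤-resp-≈ refl (+-identityˡ _) (x≤y⇒0≤y-x x≤0)

  -x*-x≈x*x : ∀ x → - x * - x ≈ x * x
  -x*-x≈x*x x = begin
    - x * - x      ≈⟨ -‿distribˡ-* x (- x) ⟨
    - (x * - x)    ≈⟨ -‿cong (-‿distribʳ-* x x) ⟨
    - (- (x * x))  ≈⟨ -‿involutive (x * x) ⟩
    x * x          ∎

  x*x-nonneg : ∀ x → 0# ≤ (x * x)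
  x*x-nonneg x with O.total 0# x
  ... | inj₁ 0≤x = *-nonneg 0≤x 0≤x
  ... | inj₂ x≤0 = ≤-resp-≈ refl (-x*-x≈x*x x) (*-nonneg (x≤0⇒0≤-x x≤0) (x≤0⇒0≤-x x≤0))

  0≤1 : 0# ≤ 1#
  0≤1 = ≤-resp-≈ refl (*-identityˡ 1#) (x*x-nonneg 1#)

  x≉0∧x*y≈0⇒y≈0 : ∀ {x y} → ¬ (x ≈ 0#) → x * y ≈ 0# → y ≈ 0#
  x≉0∧x*y≈0⇒y≈0 {x} {y} x≉0 xy≈0 with inverse x x≉0
  ... | x⁻¹ , xx⁻¹≈1 = begin
    y               ≈⟨ *-identityˡ y ⟨
    1# * y          ≈⟨ *-congʳ (trans (sym xx⁻¹≈1) (*-comm x x⁻¹)) ⟩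
    (x⁻¹ * x) * y   ≈⟨ *-assoc x⁻¹ x y ⟩
    x⁻¹ * (x * y)   ≈⟨ *-congˡ xy≈0 ⟩
    x⁻¹ * 0#        ≈⟨ zeroʳ x⁻¹ ⟩
    0#              ∎

  x≉0⇒x*x≉0 : ∀ {x} → ¬ (x ≈ 0#) → ¬ (x * x ≈ 0#)
  x≉0⇒x*x≉0 x≉0 xx≈0 = x≉0 (x≉0∧x*y≈0⇒y≈0 x≉0 xx≈0)

  nonneg-+≈1⇒≉0 : ∀ {x y} → 0# ≤ x → 0# ≤ y → (x + y) ≈ 1# → ¬ (x ≈ 0#) ⊎ ¬ (y ≈ 0#)
  nonneg-+≈1⇒≉0 {x} {y} 0≤x 0≤y x+y≈1 = larger-≉0 (O.total x y)
    where
    0≈1 : x ≈ 0# → y ≈ 0# → 0# ≈ 1#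
    0≈1 x≈0 y≈0 = trans (sym (+-identityʳ 0#)) (trans (+-cong (sym x≈0) (sym y≈0)) x+y≈1)

    larger-≉0 : x ≤ y ⊎ y ≤ x → ¬ (x ≈ 0#) ⊎ ¬ (y ≈ 0#)
    larger-≉0 (inj₁ x≤y) = inj₂ λ y≈0 → 0≉1 (0≈1 (O.antisym (≤-resp-≈ refl y≈0 x≤y) 0≤x) y≈0)
    larger-≉0 (inj₂ y≤x) = inj₁ λ x≈0 → 0≉1 (0≈1 x≈0 (O.antisym (≤-resp-≈ refl x≈0 y≤x) 0≤y))

  binary⇒unit-interval : ∀ {x} → x ≈ 0# ⊎ x ≈ 1# → 0# ≤ x × x ≤ 1#
  binary⇒unit-interval (inj₁ x≈0) = O.reflexive (sym x≈0) , ≤-resp-≈ (sym x≈0) refl 0≤1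
  binary⇒unit-interval (inj₂ x≈1) = ≤-resp-≈ refl (sym x≈1) 0≤1 , O.reflexive x≈1

  ι-nonneg : ∀ m → 0# ≤ ι F m
  ι-nonneg zero    = O.refl
  ι-nonneg (suc m) = +-nonneg 0≤1 (ι-nonneg m)

  1+ι≉0 : ∀ m → ¬ (1# + ι F m ≈ 0#)
  1+ι≉0 m 1+m≈0 = 0≉1 (O.antisym 0≤1 (O.trans (x≤x+y 1# (ι-nonneg m)) (O.reflexive 1+m≈0)))

  ι-injective : ∀ m n → ι F m ≈ ι F n → m ≡ n
  ι-injective zero    zero    _   = ≡.refl
  ι-injective zero    (suc n) eq  = contradiction (sym eq) (1+ι≉0 n)
  ι-injective (suc m) zero    eq  = contradiction eq (1+ι≉0 m)
  ι-injective (suc m) (suc n) eq  =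
    ≡.cong suc (ι-injective m n (+-cancelʳ 1# _ _ (trans (+-comm _ 1#) (trans eq (+-comm 1# _)))))

  idx-injective : ∀ {n} (i j : Fin n) → idx F i ≈ idx F j → i ≡ j
  idx-injective i j eq = toℕ-injective (ℕ.suc-injective (ι-injective _ _ eq))


  sumK≈sum : ∀ {n} (f : Fin n → Carrier) → sumK F f ≈ sum f
  sumK≈sum {zero}  f = refl
  sumK≈sum {suc n} f = +-congˡ (sumK≈sum (f ∘ fsuc))

  sumK≈⇒sum≈ : ∀ {n} (f : Fin n → Carrier) {y} → sumK F f ≈ y → sum f ≈ y
  sumK≈⇒sum≈ f eq = trans (sym (sumK≈sum f)) eq

  sum-nonneg : ∀ {n} (f : Fin n → Carrier) → (∀ i → 0# ≤ f i) → 0# ≤ sum f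
  sum-nonneg {zero}  f 0≤f = O.refl
  sum-nonneg {suc n} f 0≤f = +-nonneg (0≤f fzero) (sum-nonneg (f ∘ fsuc) (0≤f ∘ fsuc))

  sum-nonneg-≈0⇒≈0 : ∀ {n} (f : Fin n → Carrier) → (∀ i → 0# ≤ f i) → sum f ≈ 0# → ∀ i → f i ≈ 0#
  sum-nonneg-≈0⇒≈0 {suc n} f 0≤f Σf≈0 fzero    =
    +-nonneg-≤0⇒ˡ≈0 (0≤f fzero) (sum-nonneg (f ∘ fsuc) (0≤f ∘ fsuc)) (O.reflexive Σf≈0)
  sum-nonneg-≈0⇒≈0 {suc n} f 0≤f Σf≈0 (fsuc i) =
    sum-nonneg-≈0⇒≈0 (f ∘ fsuc) (0≤f ∘ fsuc)
      (+-nonneg-≤0⇒ʳ≈0 (0≤f fzero) (sum-nonneg (f ∘ fsuc) (0≤f ∘ fsuc)) (O.reflexive Σf≈0)) i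

  sum-≈0 : ∀ {n} (f : Fin n → Carrier) → (∀ i → f i ≈ 0#) → sum f ≈ 0#
  sum-≈0 {n} f f≈0 = trans (sum-cong-≋ f≈0) (sum-replicate-zero n)

  sum-supported : ∀ {n} (f : Fin n → Carrier) (k : Fin n) → (∀ i → i ≢ k → f i ≈ 0#) → sum f ≈ f k
  sum-supported {suc n} f fzero    f≈0 =
    trans (+-congˡ (sum-≈0 (f ∘ fsuc) (λ i → f≈0 (fsuc i) λ ()))) (+-identityʳ (f fzero))
  sum-supported {suc n} f (fsuc k) f≈0 =
    trans (+-cong (f≈0 fzero λ ()) (sum-supported (f ∘ fsuc) k λ i i≢k → f≈0 (fsuc i) (i≢k ∘ suc-injective)))
          (+-identityˡ (f (fsuc k)))

  sum-*-supported : ∀ {n} (g ν : Fin n → Carrier) (k : Fin n) → (∀ i → i ≢ k → ν i ≈ 0#) →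
                    sum (λ i → g i * ν i) ≈ g k * ν k
  sum-*-supported g ν k ν≈0 = sum-supported _ k (λ i i≢k → trans (*-congˡ (ν≈0 i i≢k)) (zeroʳ (g i)))

  pointMass : ∀ {n} → Fin n → Fin n → Carrier
  pointMass k i with i ≟ k
  ... | yes _ = 1#
  ... | no  _ = 0#

  pointMass-nonneg : ∀ {n} (k i : Fin n) → 0# ≤ pointMass k i
  pointMass-nonneg k i with i ≟ k
  ... | yes _ = 0≤1
  ... | no  _ = O.refl

  pointMass-diag : ∀ {n} (k : Fin n) → pointMass k k ≈ 1#
  pointMass-diag k with k ≟ k
  ... | yes _   = refl
  ... | no  k≢k = contradiction ≡.refl k≢k

  pointMass-off : ∀ {n} (k i : Fin n) → i ≢ k → pointMass k i ≈ 0#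
  pointMass-off k i i≢k with i ≟ k
  ... | yes i≡k = contradiction i≡k i≢k
  ... | no  _   = refl

  sum-*-pointMass : ∀ {n} (g : Fin n → Carrier) (k : Fin n) → sum (λ i → g i * pointMass k i) ≈ g k
  sum-*-pointMass g k = begin
    sum (λ i → g i * pointMass k i)  ≈⟨ sum-*-supported g (pointMass k) k (pointMass-off k) ⟩
    g k * pointMass k k              ≈⟨ *-congˡ (pointMass-diag k) ⟩
    g k * 1#                         ≈⟨ *-identityʳ (g k) ⟩
    g k                              ∎


  -- With a = (a − b) + b substituted on the left this is a semiring identity.
  square-expansion : ∀ a b m → ((a - b) * (a - b)) * m + (b + b) * (a * m) ≈ (a * a) * m + (b * b) * m
  square-expansion a b m = begin
    (d * d) * m + (b + b) * (a * m)        ≈⟨ +-congˡ (*-congˡ (*-congʳ a≈d+b)) ⟩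
    (d * d) * m + (b + b) * ((d + b) * m)  ≈⟨ expand d b m ⟩
    ((d + b) * (d + b)) * m + (b * b) * m  ≈⟨ +-congʳ (*-congʳ (*-cong a≈d+b a≈d+b)) ⟨
    (a * a) * m + (b * b) * m              ∎
    where
    d : Carrier
    d = a - b
    a≈d+b : a ≈ d + b
    a≈d+b = sym (//-rightDividesˡ b a)
    expand : ∀ d b m → (d * d) * m + (b + b) * ((d + b) * m) ≈ ((d + b) * (d + b)) * m + (b * b) * m
    expand = solve 3 (λ d b m → (d :* d) :* m :+ (b :+ b) :* ((d :+ b) :* m)
                              := ((d :+ b) :* (d :+ b)) :* m :+ (b :* b) :* m) refl

  variance≈0 : ∀ {n} (a μ : Fin n → Carrier) (b : Carrier) →
               sum μ ≈ 1# → sum (λ i → a i * μ i) ≈ b → sum (λ i → (a i * a i) * μ i) ≈ b * b →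
               sum (λ i → ((a i - b) * (a i - b)) * μ i) ≈ 0#
  variance≈0 a μ b Σμ≈1 Σaμ≈b Σa²μ≈b² = +-cancelʳ ((b + b) * b) _ _ (begin
    sum dev² + (b + b) * b                    ≈⟨ +-congˡ (*-congˡ Σaμ≈b) ⟨
    sum dev² + (b + b) * sum aμ               ≈⟨ +-congˡ (*-distribˡ-sum (b + b) aμ) ⟩
    sum dev² + sum (λ i → (b + b) * aμ i)     ≈⟨ ∑-distrib-+ dev² _ ⟨
    sum (λ i → dev² i + (b + b) * aμ i)       ≈⟨ sum-cong-≋ (λ i → square-expansion (a i) b (μ i)) ⟩
    sum (λ i → a²μ i + b²μ i)                 ≈⟨ ∑-distrib-+ a²μ b²μ ⟩
    sum a²μ + sum b²μ                         ≈⟨ +-cong (sym Σa²μ≈b²) (*-distribˡ-sum (b * b) μ) ⟨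
    b * b + (b * b) * sum μ                   ≈⟨ +-congˡ (*-congˡ Σμ≈1) ⟩
    b * b + (b * b) * 1#                      ≈⟨ moments b ⟩
    0# + (b + b) * b                          ∎)
    where
    dev² aμ a²μ b²μ : Fin _ → Carrier
    dev² i = ((a i - b) * (a i - b)) * μ i
    aμ i = a i * μ i
    a²μ i = (a i * a i) * μ i
    b²μ i = (b * b) * μ i
    moments : ∀ b → b * b + (b * b) * 1# ≈ 0# + (b + b) * b
    moments = solve 1 (λ b → b :* b :+ (b :* b) :* con 1 := con 0 :+ (b :+ b) :* b) refl

  variance≈0⇒supported : ∀ {n} (a μ : Fin n → Carrier) (k : Fin n) →
                         (∀ i → a i ≈ a k → i ≡ k) → (∀ i → 0# ≤ μ i) →
                         sum (λ i → ((a i - a k) * (a i - a k)) * μ i) ≈ 0# →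
                         ∀ i → i ≢ k → μ i ≈ 0#
  variance≈0⇒supported a μ k a-inj 0≤μ var≈0 i i≢k =
    x≉0∧x*y≈0⇒y≈0 (x≉0⇒x*x≉0 aᵢ-aₖ≉0)
      (sum-nonneg-≈0⇒≈0 _ (λ j → *-nonneg (x*x-nonneg (a j - a k)) (0≤μ j)) var≈0 i)
    where
    aᵢ-aₖ≉0 : ¬ (a i - a k ≈ 0#)
    aᵢ-aₖ≉0 = i≢k ∘ a-inj i ∘ x∙y⁻¹≈ε⇒x≈y _ _


  module _ {n} {k : Fin n} {lam lamb : Fin n → Carrier} where

    Feasible⇒mass-supported : Feasible F k lam lamb → ∀ i → i ≢ k → lam i + lamb i ≈ 0#
    Feasible⇒mass-supported (0≤lam , 0≤lamb , Σμ≈1 , Σiμ≈k , Σi²μ≈k²) =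
      variance≈0⇒supported (idx F) μ k (λ i → idx-injective i k) (λ i → +-nonneg (0≤lam i) (0≤lamb i))
        (variance≈0 (idx F) μ (idx F k) (sumK≈⇒sum≈ μ Σμ≈1) (sumK≈⇒sum≈ iμ Σiμ≈k) (sumK≈⇒sum≈ i²μ Σi²μ≈k²))
      where
      μ iμ i²μ : Fin n → Carrier
      μ i = lam i + lamb i
      iμ i = idx F i * μ i
      i²μ i = (idx F i * idx F i) * μ i

    Feasible⇒mass≈1 : Feasible F k lam lamb → lam k + lamb k ≈ 1#
    Feasible⇒mass≈1 feasible@(_ , _ , Σμ≈1 , _) = begin
      lam k + lamb k                ≈⟨ sum-supported μ k (Feasible⇒mass-supported feasible) ⟨
      sum μ                         ≈⟨ sumK≈⇒sum≈ μ Σμ≈1 ⟩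
      1#                            ∎
      where
      μ : Fin n → Carrier
      μ i = lam i + lamb i

    Feasible⇒supported : Feasible F k lam lamb → ∀ i → i ≢ k → lam i ≈ 0# × lamb i ≈ 0#
    Feasible⇒supported feasible@(0≤lam , 0≤lamb , _) i i≢k =
      +-nonneg-≤0⇒ˡ≈0 (0≤lam i) (0≤lamb i) μᵢ≤0 , +-nonneg-≤0⇒ʳ≈0 (0≤lam i) (0≤lamb i) μᵢ≤0
      where
      μᵢ≤0 : (lam i + lamb i) ≤ 0#
      μᵢ≤0 = O.reflexive (Feasible⇒mass-supported feasible i i≢k)

    objective-Feasible : ∀ x → Feasible F k lam lamb →
                         objective F x lam lamb ≈ x k * lam k + (1# - x k) * lamb k
    objective-Feasible x feasible = begin
      sumK F (λ i → x i * lam i) + sumK F (λ i → (1# - x i) * lamb i)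
        ≈⟨ +-cong (sumK≈sum (λ i → x i * lam i)) (sumK≈sum (λ i → (1# - x i) * lamb i)) ⟩
      sum (λ i → x i * lam i) + sum (λ i → (1# - x i) * lamb i)
        ≈⟨ +-cong (sum-*-supported x lam k (proj₁ ∘₂ supported))
                  (sum-*-supported (λ i → 1# - x i) lamb k (proj₂ ∘₂ supported)) ⟩
      x k * lam k + (1# - x k) * lamb k  ∎
      where
      supported : ∀ i → i ≢ k → lam i ≈ 0# × lamb i ≈ 0#
      supported = Feasible⇒supported feasible

    objective-nonneg : ∀ x → 0# ≤ x k → x k ≤ 1# → Feasible F k lam lamb → 0# ≤ objective F x lam lamb
    objective-nonneg x 0≤xₖ xₖ≤1 feasible@(0≤lam , 0≤lamb , _) =
      ≤-resp-≈ refl (sym (objective-Feasible x feasible))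
        (+-nonneg (*-nonneg 0≤xₖ (0≤lam k)) (*-nonneg (x≤y⇒0≤y-x xₖ≤1) (0≤lamb k)))

    Feasible-pointMass : (∀ i → 0# ≤ lam i) → (∀ i → 0# ≤ lamb i) →
                         (∀ i → lam i + lamb i ≈ pointMass k i) → Feasible F k lam lamb
    Feasible-pointMass 0≤lam 0≤lamb μ≈δ =
      0≤lam , 0≤lamb
      , moment (λ _ → 1#) (λ i → trans (μ≈δ i) (sym (*-identityˡ _)))
      , moment (idx F) (λ i → *-congˡ (μ≈δ i))
      , moment (λ i → idx F i * idx F i) (λ i → *-congˡ (μ≈δ i))
      where
      moment : ∀ {h} g → (∀ i → h i ≈ g i * pointMass k i) → sumK F h ≈ g k
      moment {h} g h≈gδ = trans (sumK≈sum h) (trans (sum-cong-≋ h≈gδ) (sum-*-pointMass g k))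


  module _ {n} (x : Fin n → Carrier) (k : Fin n) where

    binary⇒IsMinimum0 : x k ≈ 0# ⊎ x k ≈ 1# → IsMinimum F k x 0#
    binary⇒IsMinimum0 xₖ∈01 = attained xₖ∈01 , λ lam lamb → objective-nonneg x 0≤xₖ xₖ≤1
      where
      0≤xₖ : 0# ≤ x k
      0≤xₖ = proj₁ (binary⇒unit-interval xₖ∈01)
      xₖ≤1 : x k ≤ 1#
      xₖ≤1 = proj₂ (binary⇒unit-interval xₖ∈01)

      zeros : Fin n → Carrier
      zeros _ = 0#

      attained : x k ≈ 0# ⊎ x k ≈ 1# → Σ (Fin n → Carrier) λ lam → Σ (Fin n → Carrier) λ lamb →
                   Feasible F k lam lamb × objective F x lam lamb ≈ 0#
      attained (inj₁ xₖ≈0) = pointMass k , zeros , feasible , (begin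
        objective F x (pointMass k) zeros        ≈⟨ objective-Feasible x feasible ⟩
        x k * pointMass k k + (1# - x k) * 0#    ≈⟨ +-cong (*-congˡ (pointMass-diag k)) (zeroʳ _) ⟩
        x k * 1# + 0#                            ≈⟨ +-identityʳ _ ⟩
        x k * 1#                                 ≈⟨ *-identityʳ _ ⟩
        x k                                      ≈⟨ xₖ≈0 ⟩
        0#                                       ∎)
        where
        feasible : Feasible F k (pointMass k) zeros
        feasible = Feasible-pointMass (pointMass-nonneg k) (λ _ → O.refl) (λ _ → +-identityʳ _)
      attained (inj₂ xₖ≈1) = zeros , pointMass k , feasible , (begin
        objective F x zeros (pointMass k)        ≈⟨ objective-Feasible x feasible ⟩
        x k * 0# + (1# - x k) * pointMass k k    ≈⟨ +-cong (zeroʳ _) (*-congˡ (pointMass-diag k)) ⟩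
        0# + (1# - x k) * 1#                     ≈⟨ +-identityˡ _ ⟩
        (1# - x k) * 1#                          ≈⟨ *-identityʳ _ ⟩
        1# - x k                                 ≈⟨ x≈y⇒x∙y⁻¹≈ε (sym xₖ≈1) ⟩
        0#                                       ∎)
        where
        feasible : Feasible F k zeros (pointMass k)
        feasible = Feasible-pointMass (λ _ → O.refl) (pointMass-nonneg k) (λ _ → +-identityˡ _)

    IsMinimum≤0⇒binary : ∀ {v} → 0# ≤ x k → x k ≤ 1# → IsMinimum F k x v → v ≤ 0# → x k ≈ 0# ⊎ x k ≈ 1#
    IsMinimum≤0⇒binary 0≤xₖ xₖ≤1 ((lam , lamb , feasible@(0≤lam , 0≤lamb , _) , objective≈v) , _) v≤0 =
      from-nonzero-weight (nonneg-+≈1⇒≉0 (0≤lam k) (0≤lamb k) (Feasible⇒mass≈1 feasible))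
      where
      0≤xₖlamₖ : 0# ≤ (x k * lam k)
      0≤xₖlamₖ = *-nonneg 0≤xₖ (0≤lam k)
      0≤[1-xₖ]lambₖ : 0# ≤ ((1# - x k) * lamb k)
      0≤[1-xₖ]lambₖ = *-nonneg (x≤y⇒0≤y-x xₖ≤1) (0≤lamb k)
      objective≤0 : (x k * lam k + (1# - x k) * lamb k) ≤ 0#
      objective≤0 = ≤-resp-≈ (trans (sym objective≈v) (objective-Feasible x feasible)) refl v≤0

      from-nonzero-weight : ¬ (lam k ≈ 0#) ⊎ ¬ (lamb k ≈ 0#) → x k ≈ 0# ⊎ x k ≈ 1#
      from-nonzero-weight (inj₁ lamₖ≉0) = inj₁ (x≉0∧x*y≈0⇒y≈0 lamₖ≉0 (trans (*-comm _ _)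
        (+-nonneg-≤0⇒ˡ≈0 0≤xₖlamₖ 0≤[1-xₖ]lambₖ objective≤0)))
      from-nonzero-weight (inj₂ lambₖ≉0) = inj₂ (sym (x∙y⁻¹≈ε⇒x≈y _ _ (x≉0∧x*y≈0⇒y≈0 lambₖ≉0
        (trans (*-comm _ _) (+-nonneg-≤0⇒ʳ≈0 0≤xₖlamₖ 0≤[1-xₖ]lambₖ objective≤0)))))

-- The hypothesis 1 ≤ n is not needed: the index k : Fin n already forces n ≥ 1.
lemma1 : ∀ {c ℓ ℓ₂} (F : OrderedField c ℓ ℓ₂) (n : ℕ) → 1 ≤ℕ n →
    (x : Fin n → OrderedField.Carrier F) (k : Fin n) →
    let open OrderedField F in
    ((x k ≈ 0#) ⊎ (x k ≈ 1#))
    ⇔ (((0# ≤ x k) × (x k ≤ 1#))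
    × Σ Carrier (λ v → IsMinimum F k x v × (v ≤ 0#)))
lemma1 F n _ x k = mk⇔
  (λ xₖ∈01 → binary⇒unit-interval F xₖ∈01 , 0# , binary⇒IsMinimum0 F x k xₖ∈01 , O.refl)
  (λ { ((0≤xₖ , xₖ≤1) , v , minimum , v≤0) → IsMinimum≤0⇒binary F x k 0≤xₖ xₖ≤1 minimum v≤0 })
  where
  open OrderedField F
  module O = IsTotalOrder isTotalOrder
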